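{- Let $k \ge 3$, $\ell \ge 1$ and $n$ be integers satisfying $$\chi(\ell+k-1,k-1) + \ell + k - 1 \le n \le \binom{\ell+k-1}{k-1} + \ell + k - 1.$$ Then there exists a uniquely $\tau$-critical $k$-uniform hypergraph $H$ with $n$ vertices and $\tau(H) = \ell+1$.
   Context: The Johnson graph $J(m,j)$ has vertex set $\binom{[m]}{j}$, two $j$-sets being adjacent iff they intersect in exactly $j-1$ elements; $\chi(m,j)$ denotes the chromatic number of $J(m,j)$. A transversal of a hypergraph $G$ is a vertex subset meeting every edge; $\tau(G)$ is the minimum size of a transversal. $G$ is $\tau$-critical if $\tau(G-e) < \tau(G)$ for every edge $e$. $G$ is uniquely $\tau$-critical if it is $\tau$-critical and for every edge $e$, the hypergraph $G-e$ has a unique minimum transversal. -}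

module Defs where

open import Data.Nat using (ℕ; _≤_; _<_; _∸_)
open import Data.Fin using (Fin)
open import Data.Fin.Subset using (Subset; _∩_; ∣_∣; Nonempty; _∈_)
open import Data.List using (List; length; removeAt)
open import Data.List.Relation.Unary.All using (All)
open import Data.List.Relation.Unary.Any using (Any)
open import Data.List.Relation.Unary.Unique.Propositional using (Unique)
open import Data.Product using (Σ; ∃; _×_)
open import Relation.Binary.PropositionalEquality using (_≡_; _≢_)

JohnsonAdj : (m j : ℕ) → Subset m → Subset m → Set
JohnsonAdj m j A B = ∣ A ∣ ≡ j × ∣ B ∣ ≡ j × ∣ A ∩ B ∣ ≡ j ∸ 1

-- A proper colouring of J(m,j) with c colours.
-- (Colours are assigned to all subsets; only those of size j matter.)
ProperColouring : (m j c : ℕ) → Set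
ProperColouring m j c =
  Σ (Subset m → Fin c) λ f → ∀ A B → JohnsonAdj m j A B → f A ≢ f B

IsChromaticNumber : (m j c : ℕ) → Set
IsChromaticNumber m j c =
  ProperColouring m j c × (∀ c′ → ProperColouring m j c′ → c ≤ c′)

record Hypergraph (n : ℕ) : Set where
  field
    edges  : List (Subset n)
    unique : Unique edges
open Hypergraph public

deleteEdge : ∀ {n} (G : Hypergraph n) → Fin (length (edges G)) → List (Subset n)
deleteEdge G i = removeAt (edges G) i

Uniform : ∀ {n} → ℕ → Hypergraph n → Set
Uniform k G = All (λ e → ∣ e ∣ ≡ k) (edges G)

-- every vertex lies in some edge (the vertex set is exactly Fin n, no isolated vertices)
NoIsolated : ∀ {n} → Hypergraph n → Set
NoIsolated {n} G = ∀ (v : Fin n) → Any (λ e → v ∈ e) (edges G)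

IsTransversal : ∀ {n} → List (Subset n) → Subset n → Set
IsTransversal E T = All (λ e → Nonempty (e ∩ T)) E

IsMinTransversal : ∀ {n} → List (Subset n) → Subset n → Set
IsMinTransversal E T =
  IsTransversal E T × (∀ T′ → IsTransversal E T′ → ∣ T ∣ ≤ ∣ T′ ∣)

IsTau : ∀ {n} → List (Subset n) → ℕ → Set
IsTau E t = Σ _ λ T → IsMinTransversal E T × ∣ T ∣ ≡ t

TauCritical : ∀ {n} → Hypergraph n → Set
TauCritical G =
  ∀ t → IsTau (edges G) t →
  ∀ i t′ → IsTau (deleteEdge G i) t′ → t′ < t

UniquelyTauCritical : ∀ {n} → Hypergraph n → Set
UniquelyTauCritical G =
  TauCritical G ×
  (∀ i → Σ _ λ T → IsMinTransversal (deleteEdge G i) T ×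
                   (∀ T′ → IsMinTransversal (deleteEdge G i) T′ → T′ ≡ T))

module Submission where

-- Construction (for k = j + 1 with j ≥ 2 and m = ℓ + j).  Let g be a proper
-- colouring of the Johnson graph J(m, j) with c colours which uses every
-- colour.  The hypergraph H(g) has vertex set [m] ⊔ [c] and one edge
-- S ∪ {g(S)} for every j-subset S of [m]; it is k-uniform.
--
-- Everything rests on one rigidity lemma: if A ⊆ [m] and B ⊆ [c] satisfy
-- |A| + |B| ≤ ℓ and every j-set S other than a fixed S₀ either meets A or
-- has g(S) ∈ B, then A = ∁ S₀ and B = ∅.  (If |∁ A| > j, a star of j-sets
-- R ∪ {z} inside ∁ A is a clique of J(m, j), so it needs more than |B|
-- colours.)  Consequently τ(H) = ℓ + 1, and after deleting the edge of S₀
-- the set ∁ S₀ is the unique transversal of size ≤ ℓ, which gives unique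
-- τ-criticality.
--
-- Finally a surjective colouring with exactly c = n - m colours exists for
-- χ(m, j) ≤ c ≤ C(m, j): a colouring with χ colours is surjective by
-- minimality, and while c < C(m, j) two j-sets share a colour, so one of
-- them may be given a fresh colour.

open import Defs
open import Data.Nat using (ℕ; zero; suc; _≤_; _<_; _+_; _∸_; z≤n; s≤s; s≤s⁻¹; _≤′_; ≤′-refl; ≤′-step)
open import Data.Nat.Properties
open import Data.Nat.Combinatorics using (_C_; nCk+nC[k+1]≡[n+1]C[k+1])
open import Data.Nat.Tactic.RingSolver using (solve-∀)
open import Data.Bool using (true; false)
import Data.Bool as Bool
open import Data.Fin using (Fin; zero; suc; punchOut)
open import Data.Fin.Properties using (punchOut-injective; pigeonhole) renaming (_≟_ to _≟ᶠ_)
import Data.Fin.Properties as Finₚ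
open import Data.Fin.Subset
open import Data.Fin.Subset.Properties
open import Data.Vec using ([]; _∷_; _++_; _[_]≔_; splitAt; here; there)
open import Data.Vec.Properties using (≡-dec; ++-injectiveˡ; ∷-injectiveʳ; []≔-updates; []≔-minimal)
open import Data.List using (List; []; _∷_; map; length; lookup; removeAt)
import Data.List as List
open import Data.List.Properties using (length-map; length-++)
open import Data.List.Relation.Unary.Any using (Any; here; there; any?)
open import Data.List.Relation.Unary.All using (All; [])
import Data.List.Relation.Unary.All as All
open import Data.List.Relation.Unary.AllPairs using ([]; _∷_)
open import Data.List.Relation.Unary.Unique.Propositional using (Unique)
import Data.List.Relation.Unary.Unique.Propositional.Properties as Unique
open import Data.List.Membership.Propositional using (find; lose) renaming (_∈_ to _∈ˡ_)
open import Data.List.Membership.Propositional.Properties using (∈-map⁺; ∈-map⁻; ∈-++⁺ˡ; ∈-++⁺ʳ; ∈-++⁻; ∈-lookup)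
open import Data.Product using (Σ; _×_; _,_; proj₁; proj₂)
open import Data.Sum using (_⊎_; inj₁; inj₂)
open import Data.Empty using (⊥-elim)
open import Function using (_∘_)
open import Relation.Nullary using (¬_; yes; no; Dec; contradiction)
open import Relation.Binary.PropositionalEquality

-- Finite subsets: sizes, insertion, deletion, choosing subsets

_≟ˢ_ : ∀ {n} (p q : Subset n) → Dec (p ≡ q)
_≟ˢ_ = ≡-dec Bool._≟_

∁-involutive : ∀ {n} (p : Subset n) → ∁ (∁ p) ≡ p
∁-involutive []          = refl
∁-involutive (true ∷ p)  = cong (true ∷_) (∁-involutive p)
∁-involutive (false ∷ p) = cong (false ∷_) (∁-involutive p)

p∩∁p-empty : ∀ {n} (p : Subset n) → Empty (p ∩ ∁ p)
p∩∁p-empty p (x , x∈) = ∉⊥ (subst (x ∈_) (∩-inverseʳ p) x∈)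

∈⇒0<∣p∣ : ∀ {n} {p : Subset n} {x} → x ∈ p → 0 < ∣ p ∣
∈⇒0<∣p∣ x∈p = ≤-trans (s≤s z≤n) (x∈p⇒∣p-x∣<∣p∣ x∈p)

∣p∣≡0⇒p≡⊥ : ∀ {n} (p : Subset n) → ∣ p ∣ ≡ 0 → p ≡ ⊥
∣p∣≡0⇒p≡⊥ p ∣p∣≡0 = Empty-unique λ (x , x∈p) → <-irrefl (sym ∣p∣≡0) (∈⇒0<∣p∣ x∈p)

∣p∣+∣∁p∣≡n : ∀ {n} (p : Subset n) → ∣ p ∣ + ∣ ∁ p ∣ ≡ n
∣p∣+∣∁p∣≡n p = trans (cong (∣ p ∣ +_) (∣∁p∣≡n∸∣p∣ p)) (m+[n∸m]≡n (∣p∣≤n p))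

∣∁p∣≡ : ∀ {n} (p : Subset n) r → ∣ p ∣ + r ≡ n → ∣ ∁ p ∣ ≡ r
∣∁p∣≡ p r e = +-cancelˡ-≡ ∣ p ∣ _ _ (trans (∣p∣+∣∁p∣≡n p) (sym e))

disjoint-∁⇒⊆ : ∀ {n} (S R : Subset n) → Empty (S ∩ ∁ R) → S ⊆ R
disjoint-∁⇒⊆ S R empty {x} x∈S with x ∈? R
... | yes x∈R = x∈R
... | no  x∉R = ⊥-elim (empty (x , x∈p∩q⁺ (x∈S , x∉p⇒x∈∁p x∉R)))

⊆∧∣∣≡⇒≡ : ∀ {n} (p q : Subset n) → p ⊆ q → ∣ p ∣ ≡ ∣ q ∣ → p ≡ q
⊆∧∣∣≡⇒≡ []          []          _   _ = refl
⊆∧∣∣≡⇒≡ (true ∷ p)  (true ∷ q)  p⊆q e = cong (true ∷_) (⊆∧∣∣≡⇒≡ p q (drop-∷-⊆ p⊆q) (suc-injective e))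
⊆∧∣∣≡⇒≡ (false ∷ p) (false ∷ q) p⊆q e = cong (false ∷_) (⊆∧∣∣≡⇒≡ p q (drop-∷-⊆ p⊆q) e)
⊆∧∣∣≡⇒≡ (true ∷ p)  (false ∷ q) p⊆q e with p⊆q here
... | ()
⊆∧∣∣≡⇒≡ (false ∷ p) (true ∷ q)  p⊆q e =
  contradiction e (<⇒≢ (s≤s (p⊆q⇒∣p∣≤∣q∣ (drop-∷-⊆ p⊆q))))

∣p∣≡1+∣p-x∣ : ∀ {n} (p : Subset n) x → x ∈ p → ∣ p ∣ ≡ suc ∣ p [ x ]≔ outside ∣
∣p∣≡1+∣p-x∣ (true ∷ p)  zero    here        = refl
∣p∣≡1+∣p-x∣ (true ∷ p)  (suc x) (there x∈p) = cong suc (∣p∣≡1+∣p-x∣ p x x∈p)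
∣p∣≡1+∣p-x∣ (false ∷ p) (suc x) (there x∈p) = ∣p∣≡1+∣p-x∣ p x x∈p

∣p+x∣≡1+∣p∣ : ∀ {n} (p : Subset n) x → x ∉ p → ∣ p [ x ]≔ inside ∣ ≡ suc ∣ p ∣
∣p+x∣≡1+∣p∣ (true ∷ p)  zero    x∉p = contradiction here x∉p
∣p+x∣≡1+∣p∣ (false ∷ p) zero    x∉p = refl
∣p+x∣≡1+∣p∣ (true ∷ p)  (suc x) x∉p = cong suc (∣p+x∣≡1+∣p∣ p x (x∉p ∘ there))
∣p+x∣≡1+∣p∣ (false ∷ p) (suc x) x∉p = ∣p+x∣≡1+∣p∣ p x (x∉p ∘ there)

∈-[]≔⁻ : ∀ {n} (p : Subset n) x {y} b → y ≢ x → y ∈ p [ x ]≔ b → y ∈ p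
∈-[]≔⁻ (_ ∷ p) zero    {zero}  b y≢x _           = contradiction refl y≢x
∈-[]≔⁻ (_ ∷ p) zero    {suc y} b y≢x (there y∈)  = there y∈
∈-[]≔⁻ (_ ∷ p) (suc x) {zero}  b y≢x here        = here
∈-[]≔⁻ (_ ∷ p) (suc x) {suc y} b y≢x (there y∈) =
  there (∈-[]≔⁻ p x b (λ y≡x → y≢x (cong suc y≡x)) y∈)

x∉p[x]≔outside : ∀ {n} (p : Subset n) x → x ∉ p [ x ]≔ outside
x∉p[x]≔outside (_ ∷ p) zero    ()
x∉p[x]≔outside (_ ∷ p) (suc x) (there x∈) = x∉p[x]≔outside p x x∈

[]≔inside-⊆ : ∀ {n} {R Q : Subset n} {z} → R ⊆ Q → z ∈ Q → R [ z ]≔ inside ⊆ Q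
[]≔inside-⊆ {R = R} {z = z} R⊆Q z∈Q {x} x∈ with x ≟ᶠ z
... | yes refl = z∈Q
... | no  x≢z  = R⊆Q (∈-[]≔⁻ R z inside x≢z x∈)

choose : ∀ {n} (Q : Subset n) j → j ≤ ∣ Q ∣ → Σ (Subset n) λ R → R ⊆ Q × ∣ R ∣ ≡ j
choose []          zero    _       = [] , (λ ()) , refl
choose {n} (_ ∷ Q) zero    _       = ⊥ , (λ x∈⊥ → contradiction x∈⊥ ∉⊥) , ∣⊥∣≡0 n
choose (false ∷ Q) (suc j) j<∣Q∣   with choose Q (suc j) j<∣Q∣
... | R , R⊆Q , ∣R∣≡ = outside ∷ R , out⊆ R⊆Q , ∣R∣≡
choose (true ∷ Q)  (suc j) (s≤s j≤∣Q∣) with choose Q j j≤∣Q∣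
... | R , R⊆Q , ∣R∣≡ = inside ∷ R , in⊆in R⊆Q , cong suc ∣R∣≡

chooseThrough : ∀ {n} (Q : Subset n) {w} → w ∈ Q → ∀ r → suc r ≤ ∣ Q ∣ →
  Σ (Subset n) λ R → R ⊆ Q × w ∈ R × ∣ R ∣ ≡ suc r
chooseThrough Q {w} w∈Q r r<∣Q∣ =
  R′ [ w ]≔ inside ,
  []≔inside-⊆ (λ x∈R′ → ∈-[]≔⁻ Q w outside (w≢ x∈R′) (R′⊆Q′ x∈R′)) w∈Q ,
  []≔-updates R′ w ,
  trans (∣p+x∣≡1+∣p∣ R′ w (x∉p[x]≔outside Q w ∘ R′⊆Q′)) (cong suc ∣R′∣≡r)
  where
  Q′ : Subset _
  Q′ = Q [ w ]≔ outside
  chosen : Σ (Subset _) λ R → R ⊆ Q′ × ∣ R ∣ ≡ r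
  chosen = choose Q′ r (s≤s⁻¹ (subst (suc r ≤_) (∣p∣≡1+∣p-x∣ Q w w∈Q) r<∣Q∣))
  R′ : Subset _
  R′ = proj₁ chosen
  R′⊆Q′ : R′ ⊆ Q′
  R′⊆Q′ = proj₁ (proj₂ chosen)
  ∣R′∣≡r : ∣ R′ ∣ ≡ r
  ∣R′∣≡r = proj₂ (proj₂ chosen)
  w≢ : ∀ {x} → x ∈ R′ → x ≢ w
  w≢ x∈R′ refl = x∉p[x]≔outside Q w (R′⊆Q′ x∈R′)

∣Q∖R∣+∣R∣≡∣Q∣ : ∀ {n} (Q R : Subset n) → R ⊆ Q → ∣ Q ∩ ∁ R ∣ + ∣ R ∣ ≡ ∣ Q ∣
∣Q∖R∣+∣R∣≡∣Q∣ []          []          _   = refl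
∣Q∖R∣+∣R∣≡∣Q∣ (true ∷ Q)  (true ∷ R)  R⊆Q = trans (+-suc _ _) (cong suc (∣Q∖R∣+∣R∣≡∣Q∣ Q R (drop-∷-⊆ R⊆Q)))
∣Q∖R∣+∣R∣≡∣Q∣ (true ∷ Q)  (false ∷ R) R⊆Q = cong suc (∣Q∖R∣+∣R∣≡∣Q∣ Q R (drop-∷-⊆ R⊆Q))
∣Q∖R∣+∣R∣≡∣Q∣ (false ∷ Q) (true ∷ R)  R⊆Q with R⊆Q here
... | ()
∣Q∖R∣+∣R∣≡∣Q∣ (false ∷ Q) (false ∷ R) R⊆Q = ∣Q∖R∣+∣R∣≡∣Q∣ Q R (drop-∷-⊆ R⊆Q)

injection⇒∣∣≤ : ∀ {m c} (P : Subset m) (Q : Subset c) (h : Fin m → Fin c) →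
  (∀ {x y} → x ∈ P → y ∈ P → h x ≡ h y → x ≡ y) → (∀ {x} → x ∈ P → h x ∈ Q) →
  ∣ P ∣ ≤ ∣ Q ∣
injection⇒∣∣≤ []          Q h inj into = z≤n
injection⇒∣∣≤ (false ∷ P) Q h inj into =
  injection⇒∣∣≤ P Q (h ∘ suc) (λ x∈ y∈ e → Finₚ.suc-injective (inj (there x∈) (there y∈) e)) (into ∘ there)
injection⇒∣∣≤ (true ∷ P)  Q h inj into =
  subst (_ ≤_) (sym (∣p∣≡1+∣p-x∣ Q (h zero) (into here))) (s≤s (injection⇒∣∣≤ P Q′ (h ∘ suc) inj′ into′))
  where
  Q′ = Q [ h zero ]≔ outside
  inj′ : ∀ {x y} → x ∈ P → y ∈ P → h (suc x) ≡ h (suc y) → x ≡ y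
  inj′ x∈ y∈ e = Finₚ.suc-injective (inj (there x∈) (there y∈) e)
  into′ : ∀ {x} → x ∈ P → h (suc x) ∈ Q′
  into′ x∈ = []≔-minimal Q (h (suc _)) (h zero) (λ e → Finₚ.0≢1+n (sym (inj (there x∈) here e))) (into (there x∈))

-- Subsets of a disjoint union [m] ⊔ [c], written p ++ q.
∣p++q∣ : ∀ {m c} (p : Subset m) (q : Subset c) → ∣ p ++ q ∣ ≡ ∣ p ∣ + ∣ q ∣
∣p++q∣ []          q = refl
∣p++q∣ (true ∷ p)  q = cong suc (∣p++q∣ p q)
∣p++q∣ (false ∷ p) q = ∣p++q∣ p q

∩-++ : ∀ {m c} (p r : Subset m) (q s : Subset c) → (p ++ q) ∩ (r ++ s) ≡ (p ∩ r) ++ (q ∩ s)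
∩-++ []      []      q s = refl
∩-++ (x ∷ p) (y ∷ r) q s = cong (_ ∷_) (∩-++ p r q s)

Nonempty-++⁻ : ∀ {m c} (p : Subset m) (q : Subset c) → Nonempty (p ++ q) → Nonempty p ⊎ Nonempty q
Nonempty-++⁻ []          q ne                = inj₂ ne
Nonempty-++⁻ (true ∷ p)  q _                 = inj₁ (zero , here)
Nonempty-++⁻ (false ∷ p) q (suc x , there x∈) with Nonempty-++⁻ p q (x , x∈)
... | inj₁ (y , y∈) = inj₁ (suc y , there y∈)
... | inj₂ ne       = inj₂ ne

Nonempty-++⁺ˡ : ∀ {m c} (p : Subset m) (q : Subset c) → Nonempty p → Nonempty (p ++ q)
Nonempty-++⁺ˡ (_ ∷ p) q (zero , here) = zero , here
Nonempty-++⁺ˡ (_ ∷ p) q (suc x , there x∈) with Nonempty-++⁺ˡ p q (x , x∈)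
... | y , y∈ = suc y , there y∈

vertex-cases : ∀ m c (v : Fin (m + c)) →
  (Σ (Fin m) λ x → ∀ (p : Subset m) (q : Subset c) → x ∈ p → v ∈ p ++ q) ⊎
  (Σ (Fin c) λ y → ∀ (p : Subset m) (q : Subset c) → y ∈ q → v ∈ p ++ q)
vertex-cases zero    c v       = inj₂ (v , λ { [] q y∈ → y∈ })
vertex-cases (suc m) c zero    = inj₁ (zero , λ { (_ ∷ p) q here → here })
vertex-cases (suc m) c (suc v) with vertex-cases m c v
... | inj₁ (x , f) = inj₁ (suc x , λ { (_ ∷ p) q (there x∈) → there (f p q x∈) })
... | inj₂ (y , f) = inj₂ (y , λ { (_ ∷ p) q y∈ → there (f p q y∈) })

-- The list of all j-subsets of [m] (the vertices of J(m, j))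

subsetsOfSize : (m j : ℕ) → List (Subset m)
subsetsOfSize zero    zero    = [] ∷ []
subsetsOfSize zero    (suc j) = []
subsetsOfSize (suc m) zero    = map (outside ∷_) (subsetsOfSize m zero)
subsetsOfSize (suc m) (suc j) =
  map (inside ∷_) (subsetsOfSize m j) List.++ map (outside ∷_) (subsetsOfSize m (suc j))

∈subsetsOfSize⇒∣∣≡ : ∀ m j {p : Subset m} → p ∈ˡ subsetsOfSize m j → ∣ p ∣ ≡ j
∈subsetsOfSize⇒∣∣≡ zero    zero    {[]} _ = refl
∈subsetsOfSize⇒∣∣≡ (suc m) zero    p∈ with ∈-map⁻ (outside ∷_) p∈
... | q , q∈ , refl = ∈subsetsOfSize⇒∣∣≡ m zero q∈
∈subsetsOfSize⇒∣∣≡ (suc m) (suc j) p∈ with ∈-++⁻ (map (inside ∷_) (subsetsOfSize m j)) p∈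
... | inj₁ p∈ˡ with ∈-map⁻ (inside ∷_) p∈ˡ
...   | q , q∈ , refl = cong suc (∈subsetsOfSize⇒∣∣≡ m j q∈)
∈subsetsOfSize⇒∣∣≡ (suc m) (suc j) p∈ | inj₂ p∈ʳ with ∈-map⁻ (outside ∷_) p∈ʳ
...   | q , q∈ , refl = ∈subsetsOfSize⇒∣∣≡ m (suc j) q∈

∣∣≡⇒∈subsetsOfSize : ∀ m j (p : Subset m) → ∣ p ∣ ≡ j → p ∈ˡ subsetsOfSize m j
∣∣≡⇒∈subsetsOfSize zero    zero    []          e = here refl
∣∣≡⇒∈subsetsOfSize (suc m) zero    (false ∷ p) e = ∈-map⁺ (outside ∷_) (∣∣≡⇒∈subsetsOfSize m zero p e)
∣∣≡⇒∈subsetsOfSize (suc m) (suc j) (true ∷ p)  e =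
  ∈-++⁺ˡ (∈-map⁺ (inside ∷_) (∣∣≡⇒∈subsetsOfSize m j p (suc-injective e)))
∣∣≡⇒∈subsetsOfSize (suc m) (suc j) (false ∷ p) e =
  ∈-++⁺ʳ (map (inside ∷_) (subsetsOfSize m j)) (∈-map⁺ (outside ∷_) (∣∣≡⇒∈subsetsOfSize m (suc j) p e))

subsetsOfSize-unique : ∀ m j → Unique (subsetsOfSize m j)
subsetsOfSize-unique zero    zero    = [] ∷ []
subsetsOfSize-unique zero    (suc j) = []
subsetsOfSize-unique (suc m) zero    = Unique.map⁺ ∷-injectiveʳ (subsetsOfSize-unique m zero)
subsetsOfSize-unique (suc m) (suc j) =
  Unique.++⁺ (Unique.map⁺ ∷-injectiveʳ (subsetsOfSize-unique m j))
             (Unique.map⁺ ∷-injectiveʳ (subsetsOfSize-unique m (suc j))) disjoint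
  where
  disjoint : ∀ {v} → ¬ (v ∈ˡ map (inside ∷_) (subsetsOfSize m j) × v ∈ˡ map (outside ∷_) (subsetsOfSize m (suc j)))
  disjoint (v∈ˡ , v∈ʳ) with ∈-map⁻ (inside ∷_) v∈ˡ | ∈-map⁻ (outside ∷_) v∈ʳ
  ... | _ , _ , refl | _ , _ , ()

length-subsetsOfSize : ∀ m j → length (subsetsOfSize m j) ≡ m C j
length-subsetsOfSize zero    zero    = refl
length-subsetsOfSize zero    (suc j) = refl
length-subsetsOfSize (suc m) zero    =
  trans (length-map _ (subsetsOfSize m zero)) (length-subsetsOfSize m zero)
length-subsetsOfSize (suc m) (suc j) = begin
  length (map (inside ∷_) (subsetsOfSize m j) List.++ map (outside ∷_) (subsetsOfSize m (suc j)))
    ≡⟨ length-++ (map (inside ∷_) (subsetsOfSize m j)) ⟩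
  length (map (inside ∷_) (subsetsOfSize m j)) + length (map (outside ∷_) (subsetsOfSize m (suc j)))
    ≡⟨ cong₂ _+_ (length-map _ (subsetsOfSize m j)) (length-map _ (subsetsOfSize m (suc j))) ⟩
  length (subsetsOfSize m j) + length (subsetsOfSize m (suc j))
    ≡⟨ cong₂ _+_ (length-subsetsOfSize m j) (length-subsetsOfSize m (suc j)) ⟩
  m C j + m C suc j
    ≡⟨ nCk+nC[k+1]≡[n+1]C[k+1] m j ⟩
  suc m C suc j ∎
  where open ≡-Reasoning

-- Lists without repetitions: positions and deletion

module _ {A : Set} where

  lookup-injective : ∀ (xs : List A) → Unique xs → ∀ i j → i ≢ j → lookup xs i ≢ lookup xs j
  lookup-injective (x ∷ xs) (x∉ ∷ u) zero    zero    i≢j _ = i≢j refl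
  lookup-injective (x ∷ xs) (x∉ ∷ u) zero    (suc j) _   e = All.lookup x∉ (∈-lookup j) e
  lookup-injective (x ∷ xs) (x∉ ∷ u) (suc i) zero    _   e = All.lookup x∉ (∈-lookup i) (sym e)
  lookup-injective (x ∷ xs) (x∉ ∷ u) (suc i) (suc j) i≢j e =
    lookup-injective xs u i j (λ i≡j → i≢j (cong suc i≡j)) e

  ∈-removeAt⁻ : ∀ (xs : List A) i {x} → x ∈ˡ removeAt xs i → x ∈ˡ xs
  ∈-removeAt⁻ (y ∷ xs) zero    x∈         = there x∈
  ∈-removeAt⁻ (y ∷ xs) (suc i) (here refl) = here refl
  ∈-removeAt⁻ (y ∷ xs) (suc i) (there x∈)  = there (∈-removeAt⁻ xs i x∈)

  ∈-removeAt⁺ : ∀ (xs : List A) i {x} → x ∈ˡ xs → x ≢ lookup xs i → x ∈ˡ removeAt xs i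
  ∈-removeAt⁺ (y ∷ xs) zero    (here refl) x≢ = contradiction refl x≢
  ∈-removeAt⁺ (y ∷ xs) zero    (there x∈)  x≢ = x∈
  ∈-removeAt⁺ (y ∷ xs) (suc i) (here refl) x≢ = here refl
  ∈-removeAt⁺ (y ∷ xs) (suc i) (there x∈)  x≢ = there (∈-removeAt⁺ xs i x∈ x≢)

  ∈-removeAt⇒≢ : ∀ (xs : List A) i {x} → Unique xs → x ∈ˡ removeAt xs i → x ≢ lookup xs i
  ∈-removeAt⇒≢ (y ∷ xs) zero    (y∉ ∷ u) x∈          refl = All.lookup y∉ x∈ refl
  ∈-removeAt⇒≢ (y ∷ xs) (suc i) (y∉ ∷ u) (here refl) e    = All.lookup y∉ (∈-lookup i) e
  ∈-removeAt⇒≢ (y ∷ xs) (suc i) (y∉ ∷ u) (there x∈)  e    = ∈-removeAt⇒≢ xs i u x∈ e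

-- Colourings of the Johnson graph J(m, j)

IsProper : (m j c : ℕ) → (Subset m → Fin c) → Set
IsProper m j c f = ∀ A B → JohnsonAdj m j A B → f A ≢ f B

UsesAllColours : (m j c : ℕ) → (Subset m → Fin c) → Set
UsesAllColours m j c f = ∀ (y : Fin c) → Σ (Subset m) λ S → ∣ S ∣ ≡ j × f S ≡ y

SurjectiveColouring : (m j c : ℕ) → Set
SurjectiveColouring m j c = Σ (Subset m → Fin c) λ f → IsProper m j c f × UsesAllColours m j c f

johnson-irreflexive : ∀ {m} j (A : Subset m) → ¬ JohnsonAdj m (suc j) A A
johnson-irreflexive j A (∣A∣≡ , _ , ∣A∩A∣≡) =
  1+n≢n (trans (sym ∣A∣≡) (trans (cong ∣_∣ (sym (∩-idem A))) ∣A∩A∣≡))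

mergeColour : ∀ {c} → Fin (suc (suc c)) → Fin (suc (suc c)) → Fin (suc c)
mergeColour y x with y ≟ᶠ x
... | yes _   = zero
... | no  y≢x = punchOut y≢x

mergeColour-injective : ∀ {c} (y a b : Fin (suc (suc c))) → y ≢ a → y ≢ b →
  mergeColour y a ≡ mergeColour y b → a ≡ b
mergeColour-injective y a b y≢a y≢b e with y ≟ᶠ a | y ≟ᶠ b
... | yes y≡a | _       = contradiction y≡a y≢a
... | no  _   | yes y≡b = contradiction y≡b y≢b
... | no  y≢a′ | no y≢b′ = punchOut-injective y≢a′ y≢b′ e

optimal⇒usesAllColours : ∀ m j χ → IsChromaticNumber m (suc j) χ →
  (Σ (Subset m) λ S → ∣ S ∣ ≡ suc j) → SurjectiveColouring m (suc j) χ
optimal⇒usesAllColours m j χ ((f , f-proper) , optimal) (S₀ , ∣S₀∣≡) = f , f-proper , usesAll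
  where
  vertices : List (Subset m)
  vertices = subsetsOfSize m (suc j)
  -- For one colour, S₀ uses it; otherwise merging an unused colour into
  -- another would properly colour J(m, j) with fewer colours.
  colourUsed : ∀ {c} (y : Fin c) (f : Subset m → Fin c) → IsProper m (suc j) c f →
    (∀ c′ → ProperColouring m (suc j) c′ → c ≤ c′) → ¬ ¬ Any (λ S → f S ≡ y) vertices
  colourUsed {suc zero}    zero f _ _ unused with f S₀ in fS₀≡
  ... | zero = unused (lose (∣∣≡⇒∈subsetsOfSize m (suc j) S₀ ∣S₀∣≡) fS₀≡)
  colourUsed {suc (suc c)} y  f f-proper optimal unused =
    <-irrefl refl (optimal (suc c) (mergeColour y ∘ f , merged-proper))
    where
    avoids : ∀ S → ∣ S ∣ ≡ suc j → y ≢ f S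
    avoids S ∣S∣≡ y≡fS = unused (lose (∣∣≡⇒∈subsetsOfSize m (suc j) S ∣S∣≡) (sym y≡fS))
    merged-proper : IsProper m (suc j) (suc c) (mergeColour y ∘ f)
    merged-proper A B adj@(∣A∣≡ , ∣B∣≡ , _) e =
      f-proper A B adj (mergeColour-injective y (f A) (f B) (avoids A ∣A∣≡) (avoids B ∣B∣≡) e)
  usesAll : UsesAllColours m (suc j) χ f
  usesAll y with any? (λ S → f S ≟ᶠ y) vertices
  ... | yes used with find used
  ...   | S , S∈ , fS≡y = S , ∈subsetsOfSize⇒∣∣≡ m (suc j) S∈ , fS≡y
  usesAll y | no unused = ⊥-elim (colourUsed y f f-proper optimal unused)

-- If fewer than C(m, j) colours are used, two vertices share a colour;
-- recolouring one of them with a new colour keeps the colouring proper and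
-- surjective.
addColour : ∀ m j c → c < length (subsetsOfSize m (suc j)) →
  SurjectiveColouring m (suc j) c → SurjectiveColouring m (suc j) (suc c)
addColour m j c c<N (f , f-proper , usesAll)
  with pigeonhole c<N (λ i → f (lookup (subsetsOfSize m (suc j)) i))
... | i , i′ , i<i′ , sameColour = f′ , f′-proper , f′-usesAll
  where
  vertices : List (Subset m)
  vertices = subsetsOfSize m (suc j)
  S₁ S₂ : Subset m
  S₁ = lookup vertices i
  S₂ = lookup vertices i′
  S₁≢S₂ : S₁ ≢ S₂
  S₁≢S₂ = lookup-injective vertices (subsetsOfSize-unique m (suc j)) i i′ (Finₚ.<⇒≢ i<i′)
  ∣Sᵢ∣≡ : ∀ i → ∣ lookup vertices i ∣ ≡ suc j
  ∣Sᵢ∣≡ i = ∈subsetsOfSize⇒∣∣≡ m (suc j) (∈-lookup i)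
  f′ : Subset m → Fin (suc c)
  f′ S with S ≟ˢ S₁
  ... | yes _ = zero
  ... | no  _ = suc (f S)
  f′-S₁ : f′ S₁ ≡ zero
  f′-S₁ with S₁ ≟ˢ S₁
  ... | yes _     = refl
  ... | no  S₁≢S₁ = contradiction refl S₁≢S₁
  f′-other : ∀ {S} → S ≢ S₁ → f′ S ≡ suc (f S)
  f′-other {S} S≢S₁ with S ≟ˢ S₁
  ... | yes S≡S₁ = contradiction S≡S₁ S≢S₁
  ... | no  _    = refl
  f′-proper : IsProper m (suc j) (suc c) f′
  f′-proper A B adj e with A ≟ˢ S₁ | B ≟ˢ S₁
  ... | yes refl | yes refl = johnson-irreflexive j A adj
  ... | yes _    | no  _    = Finₚ.0≢1+n e
  ... | no  _    | yes _    = Finₚ.0≢1+n (sym e)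
  ... | no  _    | no  _    = f-proper A B adj (Finₚ.suc-injective e)
  f′-usesAll : UsesAllColours m (suc j) (suc c) f′
  f′-usesAll zero = S₁ , ∣Sᵢ∣≡ i , f′-S₁
  f′-usesAll (suc y) with usesAll y
  ... | S , ∣S∣≡ , fS≡y with S ≟ˢ S₁
  ...   | no  S≢S₁ = S , ∣S∣≡ , trans (f′-other S≢S₁) (cong suc fS≡y)
  ...   | yes refl = S₂ , ∣Sᵢ∣≡ i′ ,
                     trans (f′-other (S₁≢S₂ ∘ sym)) (cong suc (trans (sym sameColour) fS≡y))

moreColours : ∀ m j {c c′} → c ≤′ c′ → c′ ≤ m C suc j →
  SurjectiveColouring m (suc j) c → SurjectiveColouring m (suc j) c′
moreColours m j ≤′-refl              _       colouring = colouring
moreColours m j (≤′-step {c′} c≤′c′) c′<N colouring =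
  addColour m j c′ (subst (c′ <_) (sym (length-subsetsOfSize m (suc j))) c′<N)
    (moreColours m j c≤′c′ (<⇒≤ c′<N) colouring)

-- Stars in J(m, j) and the rigidity lemma

-- The sets R ∪ {z} (z ∉ R, |R| = r) pairwise meet in R, so they form a
-- clique of J(m, r + 1): a proper colouring gives them distinct colours.
star-bound : ∀ {m c r} (g : Subset m → Fin c) → IsProper m (suc r) c g →
  (R D : Subset m) (B : Subset c) → ∣ R ∣ ≡ r → (∀ {z} → z ∈ D → z ∉ R) →
  (∀ {z} → z ∈ D → g (R [ z ]≔ inside) ∈ B) → ∣ D ∣ ≤ ∣ B ∣
star-bound {m} {c} {r} g g-proper R D B ∣R∣≡r outside-R colours∈B =
  injection⇒∣∣≤ D B (λ z → g (star z)) injective colours∈B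
  where
  star : Fin m → Subset m
  star z = R [ z ]≔ inside
  ∣star∣ : ∀ {z} → z ∈ D → ∣ star z ∣ ≡ suc r
  ∣star∣ {z} z∈D = trans (∣p+x∣≡1+∣p∣ R z (outside-R z∈D)) (cong suc ∣R∣≡r)
  R∈star : ∀ {x z} → z ∈ D → x ∈ R → x ∈ star z
  R∈star z∈D x∈R = []≔-minimal R _ _ (λ { refl → outside-R z∈D x∈R }) x∈R
  star∩star : ∀ {z z′} → z ∈ D → z′ ∈ D → z ≢ z′ → star z ∩ star z′ ≡ R
  star∩star {z} {z′} z∈D z′∈D z≢z′ = ⊆-antisym ⊆R R⊆
    where
    ⊆R : star z ∩ star z′ ⊆ R
    ⊆R {x} x∈ with x∈p∩q⁻ (star z) (star z′) x∈ | x ≟ᶠ z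
    ... | _    , x∈z′ | yes refl = ∈-[]≔⁻ R z′ inside z≢z′ x∈z′
    ... | x∈z  , _    | no  x≢z  = ∈-[]≔⁻ R z inside x≢z x∈z
    R⊆ : R ⊆ star z ∩ star z′
    R⊆ x∈R = x∈p∩q⁺ (R∈star z∈D x∈R , R∈star z′∈D x∈R)
  injective : ∀ {z z′} → z ∈ D → z′ ∈ D → g (star z) ≡ g (star z′) → z ≡ z′
  injective {z} {z′} z∈D z′∈D e with z ≟ᶠ z′
  ... | yes z≡z′ = z≡z′
  ... | no  z≢z′ = contradiction e (g-proper (star z) (star z′)
          (∣star∣ z∈D , ∣star∣ z′∈D , trans (cong ∣_∣ (star∩star z∈D z′∈D z≢z′)) ∣R∣≡r))

module Rigidity (ℓ p : ℕ) {m c : ℕ} (m≡ℓ+j : m ≡ ℓ + suc (suc p))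
                (g : Subset m → Fin c) (g-proper : IsProper m (suc (suc p)) c g) where

  j : ℕ
  j = suc (suc p)

  CoversAllBut : Subset m → Subset m → Subset c → Set
  CoversAllBut S₀ A B = ∀ S → ∣ S ∣ ≡ j → S ≢ S₀ → Nonempty (S ∩ A) ⊎ g S ∈ B

  colour∈B : ∀ {S₀ A B} → CoversAllBut S₀ A B → ∀ S → ∣ S ∣ ≡ j → S ≢ S₀ → S ⊆ ∁ A → g S ∈ B
  colour∈B cover S ∣S∣≡ S≢S₀ S⊆∁A with cover S ∣S∣≡ S≢S₀
  ... | inj₁ (x , x∈) = contradiction (proj₂ (x∈p∩q⁻ S _ x∈)) (x∈∁p⇒x∉p (S⊆∁A (proj₁ (x∈p∩q⁻ S _ x∈))))
  ... | inj₂ gS∈B     = gS∈B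

  -- Too large a complement is impossible: choose R ⊆ ∁ A of size j - 1
  -- through a point w ∉ S₀; the star of j-sets R ∪ {z}, z ∈ ∁ A ∖ R, avoids
  -- A and S₀, so it needs |∁ A| - (j - 1) > |B| colours of B.
  large-complement-impossible : ∀ {S₀ A B} → ∣ S₀ ∣ ≡ j → CoversAllBut S₀ A B →
    j + ∣ B ∣ ≤ ∣ ∁ A ∣ → ¬ (j < ∣ ∁ A ∣)
  large-complement-impossible {S₀} {A} {B} ∣S₀∣≡ cover bound j<∣∁A∣ with nonempty? (∁ A ∩ ∁ S₀)
  ... | no ∁A∖S₀-empty =
    <⇒≱ j<∣∁A∣ (subst (∣ ∁ A ∣ ≤_) ∣S₀∣≡ (p⊆q⇒∣p∣≤∣q∣ (disjoint-∁⇒⊆ (∁ A) S₀ ∁A∖S₀-empty)))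
  ... | yes (w , w∈) = <-irrefl refl (begin-strict
      ∣ ∁ A ∣          ≡⟨ sym (∣Q∖R∣+∣R∣≡∣Q∣ (∁ A) R R⊆∁A) ⟩
      ∣ D ∣ + ∣ R ∣    ≡⟨ cong (∣ D ∣ +_) ∣R∣≡ ⟩
      ∣ D ∣ + suc p    ≤⟨ +-monoˡ-≤ (suc p) ∣D∣≤∣B∣ ⟩
      ∣ B ∣ + suc p    ≡⟨ +-comm ∣ B ∣ (suc p) ⟩
      suc p + ∣ B ∣    <⟨ n<1+n _ ⟩
      j + ∣ B ∣        ≤⟨ bound ⟩
      ∣ ∁ A ∣          ∎)
    where
    open ≤-Reasoning
    w∈∁A : w ∈ ∁ A
    w∈∁A = proj₁ (x∈p∩q⁻ (∁ A) (∁ S₀) w∈)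
    w∉S₀ : w ∉ S₀
    w∉S₀ = x∈∁p⇒x∉p (proj₂ (x∈p∩q⁻ (∁ A) (∁ S₀) w∈))
    chosen : Σ (Subset m) λ R → R ⊆ ∁ A × w ∈ R × ∣ R ∣ ≡ suc p
    chosen = chooseThrough (∁ A) w∈∁A p (≤-trans (n≤1+n (suc p)) (<⇒≤ j<∣∁A∣))
    R : Subset m
    R = proj₁ chosen
    R⊆∁A : R ⊆ ∁ A
    R⊆∁A = proj₁ (proj₂ chosen)
    w∈R : w ∈ R
    w∈R = proj₁ (proj₂ (proj₂ chosen))
    ∣R∣≡ : ∣ R ∣ ≡ suc p
    ∣R∣≡ = proj₂ (proj₂ (proj₂ chosen))
    D : Subset m
    D = ∁ A ∩ ∁ R
    z∉R : ∀ {z} → z ∈ D → z ∉ R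
    z∉R z∈D = x∈∁p⇒x∉p (proj₂ (x∈p∩q⁻ (∁ A) (∁ R) z∈D))
    star-colour∈B : ∀ {z} → z ∈ D → g (R [ z ]≔ inside) ∈ B
    star-colour∈B {z} z∈D = colour∈B cover (R [ z ]≔ inside)
      (trans (∣p+x∣≡1+∣p∣ R z (z∉R z∈D)) (cong suc ∣R∣≡))
      (λ star≡S₀ → w∉S₀ (subst (w ∈_) star≡S₀ ([]≔-minimal R w z (λ { refl → z∉R z∈D w∈R }) w∈R)))
      ([]≔inside-⊆ R⊆∁A (proj₁ (x∈p∩q⁻ (∁ A) (∁ R) z∈D)))
    ∣D∣≤∣B∣ : ∣ D ∣ ≤ ∣ B ∣
    ∣D∣≤∣B∣ = star-bound g g-proper R D B ∣R∣≡ z∉R star-colour∈B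

  -- From |A| + |B| ≤ ℓ and |A| + |∁ A| = ℓ + j.
  complement-bound : ∀ {A : Subset m} {B : Subset c} → ∣ A ∣ + ∣ B ∣ ≤ ℓ → j + ∣ B ∣ ≤ ∣ ∁ A ∣
  complement-bound {A} {B} small = +-cancelˡ-≤ ∣ A ∣ _ _ (begin
    ∣ A ∣ + (j + ∣ B ∣)  ≡⟨ rearrange (∣ A ∣) j (∣ B ∣) ⟩
    ∣ A ∣ + ∣ B ∣ + j    ≤⟨ +-monoˡ-≤ j small ⟩
    ℓ + j                ≡⟨ sym (trans (∣p∣+∣∁p∣≡n A) m≡ℓ+j) ⟩
    ∣ A ∣ + ∣ ∁ A ∣      ∎)
    where
    open ≤-Reasoning
    rearrange : ∀ a b c → a + (b + c) ≡ a + c + b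
    rearrange = solve-∀

  rigidity : ∀ {S₀ A B} → ∣ S₀ ∣ ≡ j → CoversAllBut S₀ A B → ∣ A ∣ + ∣ B ∣ ≤ ℓ →
    A ≡ ∁ S₀ × B ≡ ⊥
  rigidity {S₀} {A} {B} ∣S₀∣≡ cover small
    with m≤n⇒m<n∨m≡n (≤-trans (m≤m+n j ∣ B ∣) (complement-bound {A} {B} small))
  ... | inj₁ j<∣∁A∣ = ⊥-elim (large-complement-impossible ∣S₀∣≡ cover (complement-bound {A} {B} small) j<∣∁A∣)
  ... | inj₂ j≡∣∁A∣ = A≡∁S₀ , B≡⊥
    where
    ∣B∣≡0 : ∣ B ∣ ≡ 0
    ∣B∣≡0 = n≤0⇒n≡0 (+-cancelˡ-≤ j _ 0
      (subst (j + ∣ B ∣ ≤_) (trans (sym j≡∣∁A∣) (sym (+-identityʳ j))) (complement-bound {A} {B} small)))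
    B≡⊥ : B ≡ ⊥
    B≡⊥ = ∣p∣≡0⇒p≡⊥ B ∣B∣≡0
    -- ∁ A is a j-set avoiding A, and B has no colours, so ∁ A must be S₀.
    A≡∁S₀ : A ≡ ∁ S₀
    A≡∁S₀ with ∁ A ≟ˢ S₀
    ... | yes ∁A≡S₀ = trans (sym (∁-involutive A)) (cong ∁ ∁A≡S₀)
    ... | no  ∁A≢S₀ =
      ⊥-elim (<-irrefl (sym ∣B∣≡0) (∈⇒0<∣p∣ (colour∈B cover (∁ A) (sym j≡∣∁A∣) ∁A≢S₀ (λ x∈ → x∈))))

-- Transversals

IsTau⇒≤ : ∀ {n} {E : List (Subset n)} {t T} → IsTau E t → IsTransversal E T → t ≤ ∣ T ∣
IsTau⇒≤ (_ , (_ , minimum) , refl) T-transversal = minimum _ T-transversal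

onlySmall⇒minimum : ∀ {n} {E : List (Subset n)} {T t} → IsTransversal E T → ∣ T ∣ ≡ t →
  (∀ T′ → IsTransversal E T′ → ∣ T′ ∣ ≤ t → T′ ≡ T) → IsMinTransversal E T
onlySmall⇒minimum {E = E} {T = T} T-transversal refl onlySmall = T-transversal , atMost
  where
  atMost : ∀ T′ → IsTransversal E T′ → ∣ T ∣ ≤ ∣ T′ ∣
  atMost T′ T′-transversal with ≤-total ∣ T ∣ ∣ T′ ∣
  ... | inj₁ ∣T∣≤∣T′∣ = ∣T∣≤∣T′∣
  ... | inj₂ ∣T′∣≤∣T∣ = ≤-reflexive (cong ∣_∣ (sym (onlySmall T′ T′-transversal ∣T′∣≤∣T∣)))

-- The hypergraph H(g) on [m] ⊔ [c]

module Construction (ℓ p : ℕ) {m c : ℕ} (m≡ℓ+j : m ≡ ℓ + suc (suc p))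
                    (g : Subset m → Fin c) (g-proper : IsProper m (suc (suc p)) c g)
                    (g-usesAll : UsesAllColours m (suc (suc p)) c g) where

  open Rigidity ℓ p m≡ℓ+j g g-proper

  edge : Subset m → Subset (m + c)
  edge S = S ++ ⁅ g S ⁆

  edge-injective : ∀ {S S′} → edge S ≡ edge S′ → S ≡ S′
  edge-injective {S} {S′} = ++-injectiveˡ S S′

  E : List (Subset (m + c))
  E = map edge (subsetsOfSize m j)

  E-unique : Unique E
  E-unique = Unique.map⁺ edge-injective (subsetsOfSize-unique m j)

  H : Hypergraph (m + c)
  H = record { edges = E ; unique = E-unique }

  ∈E⇒edge : ∀ {e} → e ∈ˡ E → Σ (Subset m) λ S → ∣ S ∣ ≡ j × e ≡ edge S
  ∈E⇒edge e∈E with ∈-map⁻ edge e∈E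
  ... | S , S∈ , refl = S , ∈subsetsOfSize⇒∣∣≡ m j S∈ , refl

  edge∈E : ∀ S → ∣ S ∣ ≡ j → edge S ∈ˡ E
  edge∈E S ∣S∣≡ = ∈-map⁺ edge (∣∣≡⇒∈subsetsOfSize m j S ∣S∣≡)

  all-edges : ∀ {P : Subset (m + c) → Set} (E′ : List (Subset (m + c))) → (∀ {e} → e ∈ˡ E′ → e ∈ˡ E) →
    (∀ S → ∣ S ∣ ≡ j → edge S ∈ˡ E′ → P (edge S)) → All P E′
  all-edges {P} E′ E′⊆E P-edge = All.tabulate λ e∈E′ → at e∈E′ (∈E⇒edge (E′⊆E e∈E′))
    where
    at : ∀ {e} → e ∈ˡ E′ → Σ (Subset m) (λ S → ∣ S ∣ ≡ j × e ≡ edge S) → P e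
    at e∈E′ (S , ∣S∣≡ , refl) = P-edge S ∣S∣≡ e∈E′

  uniform : Uniform (suc j) H
  uniform = all-edges E (λ e∈E → e∈E) λ S ∣S∣≡ _ →
    trans (∣p++q∣ S ⁅ g S ⁆) (trans (cong₂ _+_ ∣S∣≡ (∣⁅x⁆∣≡1 (g S))) (+-comm j 1))

  j≤m : j ≤ ∣ ⊤ {m} ∣
  j≤m = subst (j ≤_) (trans (sym m≡ℓ+j) (sym (∣⊤∣≡n m))) (m≤n+m j ℓ)

  -- Points of [m] lie in some j-set; colours are used by g.
  noIsolated : NoIsolated H
  noIsolated v with vertex-cases m c v
  ... | inj₁ (x , x∈⇒v∈) with chooseThrough (⊤ {m}) ∈⊤ (suc p) j≤m
  ...   | S , _ , x∈S , ∣S∣≡ = lose (edge∈E S ∣S∣≡) (x∈⇒v∈ S ⁅ g S ⁆ x∈S)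
  noIsolated v | inj₂ (y , y∈⇒v∈) with g-usesAll y
  ...   | S , ∣S∣≡ , refl = lose (edge∈E S ∣S∣≡) (y∈⇒v∈ S ⁅ g S ⁆ (x∈⁅x⁆ (g S)))

  meets-edge⁻ : ∀ S A B → Nonempty (edge S ∩ (A ++ B)) → Nonempty (S ∩ A) ⊎ g S ∈ B
  meets-edge⁻ S A B meets with Nonempty-++⁻ (S ∩ A) (⁅ g S ⁆ ∩ B) (subst Nonempty (∩-++ S A ⁅ g S ⁆ B) meets)
  ... | inj₁ S∩A       = inj₁ S∩A
  ... | inj₂ (y , y∈)  = inj₂ (subst (_∈ B) (x∈⁅y⁆⇒x≡y (g S) (proj₁ (x∈p∩q⁻ _ B y∈))) (proj₂ (x∈p∩q⁻ _ B y∈)))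

  complement-meets : ∀ R S → ¬ S ⊆ R → Nonempty (edge S ∩ (∁ R ++ ⊥))
  complement-meets R S S⊈R with nonempty? (S ∩ ∁ R)
  ... | yes S∩∁R = subst Nonempty (sym (∩-++ S (∁ R) ⁅ g S ⁆ ⊥)) (Nonempty-++⁺ˡ (S ∩ ∁ R) _ S∩∁R)
  ... | no  S∖R-empty = ⊥-elim (S⊈R (λ {x} → disjoint-∁⇒⊆ S R S∖R-empty {x}))

  ∣∁S++⊥∣ : ∀ S r → ∣ S ∣ + r ≡ m → ∣ ∁ S ++ ⊥ {c} ∣ ≡ r
  ∣∁S++⊥∣ S r e = trans (∣p++q∣ (∁ S) ⊥) (trans (cong₂ _+_ (∣∁p∣≡ S r e) (∣⊥∣≡0 c)) (+-identityʳ r))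

  small-transversal : ∀ (E′ : List (Subset (m + c))) S₀ → ∣ S₀ ∣ ≡ j →
    (∀ S → ∣ S ∣ ≡ j → S ≢ S₀ → edge S ∈ˡ E′) →
    ∀ T → IsTransversal E′ T → ∣ T ∣ ≤ ℓ → T ≡ ∁ S₀ ++ ⊥
  small-transversal E′ S₀ ∣S₀∣≡ contains T T-transversal ∣T∣≤ℓ with splitAt m T
  ... | A , B , refl with rigidity ∣S₀∣≡ covers (subst (_≤ ℓ) (∣p++q∣ A B) ∣T∣≤ℓ)
    where
    covers : CoversAllBut S₀ A B
    covers S ∣S∣≡ S≢S₀ = meets-edge⁻ S A B (All.lookup T-transversal (contains S ∣S∣≡ S≢S₀))
  ...   | refl , refl = refl

  S* : Subset m
  S* = proj₁ (choose (⊤ {m}) j j≤m)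

  ∣S*∣≡j : ∣ S* ∣ ≡ j
  ∣S*∣≡j = proj₂ (proj₂ (choose (⊤ {m}) j j≤m))

  -- A transversal of size ≤ ℓ would be ∁ S* ++ ∅, which misses edge S*.
  transversal-large : ∀ T → IsTransversal E T → ℓ + 1 ≤ ∣ T ∣
  transversal-large T T-transversal with ∣ T ∣ ≤? ℓ
  ... | no  ∣T∣≰ℓ = subst (_≤ ∣ T ∣) (+-comm 1 ℓ) (≰⇒> ∣T∣≰ℓ)
  ... | yes ∣T∣≤ℓ
    with small-transversal E S* ∣S*∣≡j (λ S ∣S∣≡ _ → edge∈E S ∣S∣≡) T T-transversal ∣T∣≤ℓ
  ...   | refl with meets-edge⁻ S* (∁ S*) ⊥ (All.lookup T-transversal (edge∈E S* ∣S*∣≡j))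
  ...     | inj₁ S*∩∁S* = ⊥-elim (p∩∁p-empty S* S*∩∁S*)
  ...     | inj₂ gS*∈⊥  = ⊥-elim (∉⊥ gS*∈⊥)

  τ-large : ∀ {t} → IsTau E t → ℓ + 1 ≤ t
  τ-large (T , (T-transversal , _) , refl) = transversal-large T T-transversal

  -- The complement of any (j - 1)-set R₀ is a transversal of size ℓ + 1.
  tau : IsTau E (ℓ + 1)
  tau = T₀ , T₀-minimum , ∣T₀∣
    where
    R₀-choice : Σ (Subset m) λ R → R ⊆ ⊤ × ∣ R ∣ ≡ suc p
    R₀-choice = choose (⊤ {m}) (suc p) (≤-trans (n≤1+n (suc p)) j≤m)
    R₀ : Subset m
    R₀ = proj₁ R₀-choice
    T₀ : Subset (m + c)
    T₀ = ∁ R₀ ++ ⊥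
    ∣T₀∣ : ∣ T₀ ∣ ≡ ℓ + 1
    ∣T₀∣ = ∣∁S++⊥∣ R₀ (ℓ + 1) (begin
      ∣ R₀ ∣ + (ℓ + 1)      ≡⟨ cong (_+ (ℓ + 1)) (proj₂ (proj₂ R₀-choice)) ⟩
      suc p + (ℓ + 1)      ≡⟨ rearrange p ℓ ⟩
      ℓ + suc (suc p)      ≡⟨ sym m≡ℓ+j ⟩
      m                    ∎)
      where
      open ≡-Reasoning
      rearrange : ∀ p ℓ → suc p + (ℓ + 1) ≡ ℓ + suc (suc p)
      rearrange = solve-∀
    -- no j-set fits inside the (j - 1)-set R₀
    T₀-minimum : IsMinTransversal E T₀
    T₀-minimum = all-edges E (λ e∈E → e∈E) (λ S ∣S∣≡ _ → complement-meets R₀ S λ S⊆R₀ →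
                  <-irrefl refl (subst₂ _≤_ ∣S∣≡ (proj₂ (proj₂ R₀-choice)) (p⊆q⇒∣p∣≤∣q∣ S⊆R₀))) ,
                λ T T-transversal → subst (_≤ ∣ T ∣) (sym ∣T₀∣) (transversal-large T T-transversal)

  module Deleted (i : Fin (length E)) where

    Eᵢ : List (Subset (m + c))
    Eᵢ = removeAt E i

    S₀ : Subset m
    S₀ = proj₁ (∈E⇒edge (∈-lookup i))

    ∣S₀∣≡j : ∣ S₀ ∣ ≡ j
    ∣S₀∣≡j = proj₁ (proj₂ (∈E⇒edge (∈-lookup i)))

    lookup≡edge : lookup E i ≡ edge S₀
    lookup≡edge = proj₂ (proj₂ (∈E⇒edge (∈-lookup i)))

    contains : ∀ S → ∣ S ∣ ≡ j → S ≢ S₀ → edge S ∈ˡ Eᵢ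
    contains S ∣S∣≡ S≢S₀ = ∈-removeAt⁺ E i (edge∈E S ∣S∣≡) (λ e → S≢S₀ (edge-injective (trans e lookup≡edge)))

    Tᵢ : Subset (m + c)
    Tᵢ = ∁ S₀ ++ ⊥

    ∣Tᵢ∣≡ℓ : ∣ Tᵢ ∣ ≡ ℓ
    ∣Tᵢ∣≡ℓ = ∣∁S++⊥∣ S₀ ℓ (trans (cong (_+ ℓ) ∣S₀∣≡j) (trans (+-comm j ℓ) (sym m≡ℓ+j)))

    -- every remaining edge belongs to a j-set S ≠ S₀, which is not inside S₀
    Tᵢ-transversal : IsTransversal Eᵢ Tᵢ
    Tᵢ-transversal = all-edges Eᵢ (∈-removeAt⁻ E i) λ S ∣S∣≡ e∈Eᵢ → complement-meets S₀ S λ S⊆S₀ →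
      ∈-removeAt⇒≢ E i E-unique e∈Eᵢ
        (trans (cong edge (⊆∧∣∣≡⇒≡ S S₀ S⊆S₀ (trans ∣S∣≡ (sym ∣S₀∣≡j)))) (sym lookup≡edge))

    onlySmall : ∀ T → IsTransversal Eᵢ T → ∣ T ∣ ≤ ℓ → T ≡ Tᵢ
    onlySmall = small-transversal Eᵢ S₀ ∣S₀∣≡j contains

    Tᵢ-minimum : IsMinTransversal Eᵢ Tᵢ
    Tᵢ-minimum = onlySmall⇒minimum Tᵢ-transversal ∣Tᵢ∣≡ℓ onlySmall

  uniquelyTauCritical : UniquelyTauCritical H
  uniquelyTauCritical = critical , uniqueMinimum
    where
    critical : TauCritical H
    critical t τ≡t i t′ τᵢ≡t′ = begin-strict
      t′       ≤⟨ IsTau⇒≤ τᵢ≡t′ Tᵢ-transversal ⟩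
      ∣ Tᵢ ∣   ≡⟨ ∣Tᵢ∣≡ℓ ⟩
      ℓ        <⟨ m<m+n ℓ (s≤s z≤n) ⟩
      ℓ + 1    ≤⟨ τ-large τ≡t ⟩
      t        ∎
      where
      open Deleted i
      open ≤-Reasoning
    uniqueMinimum : ∀ i → Σ _ λ T → IsMinTransversal (removeAt E i) T ×
                                     (∀ T′ → IsMinTransversal (removeAt E i) T′ → T′ ≡ T)
    uniqueMinimum i = Tᵢ , Tᵢ-minimum , λ T′ (T′-transversal , T′-minimum) →
      onlySmall T′ T′-transversal (≤-trans (T′-minimum Tᵢ Tᵢ-transversal) (≤-reflexive ∣Tᵢ∣≡ℓ))
      where open Deleted i

surjectiveColouring : ∀ m j χ c → IsChromaticNumber m (suc j) χ → suc j ≤ m →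
  χ ≤ c → c ≤ m C suc j → SurjectiveColouring m (suc j) c
surjectiveColouring m j χ c chromatic j≤m χ≤c c≤N =
  moreColours m j (≤⇒≤′ χ≤c) c≤N (optimal⇒usesAllColours m j χ chromatic (S , ∣S∣≡))
  where
  vertex : Σ (Subset m) λ S → S ⊆ ⊤ × ∣ S ∣ ≡ suc j
  vertex = choose (⊤ {m}) (suc j) (subst (suc j ≤_) (sym (∣⊤∣≡n m)) j≤m)
  S : Subset m
  S = proj₁ vertex
  ∣S∣≡ : ∣ S ∣ ≡ suc j
  ∣S∣≡ = proj₂ (proj₂ vertex)

construction : ∀ ℓ p {m c} → m ≡ ℓ + suc (suc p) → SurjectiveColouring m (suc (suc p)) c →
  Σ (Hypergraph (m + c)) λ H →
    Uniform (suc (suc (suc p))) H × NoIsolated H × UniquelyTauCritical H × IsTau (edges H) (ℓ + 1)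
construction ℓ p m≡ℓ+j (g , g-proper , g-usesAll) = H , uniform , noIsolated , uniquelyTauCritical , tau
  where open Construction ℓ p m≡ℓ+j g g-proper g-usesAll

-- With k = j + 1 and m = ℓ + k - 1, take c = n - m colours.
theorem6 : ∀ (k ℓ n : ℕ) → 3 ≤ k → 1 ≤ ℓ →
    ∀ (χ : ℕ) → IsChromaticNumber (ℓ + k ∸ 1) (k ∸ 1) χ →
    χ + (ℓ + k ∸ 1) ≤ n →
    n ≤ ((ℓ + k ∸ 1) C (k ∸ 1)) + (ℓ + k ∸ 1) →
    Σ (Hypergraph n) λ H →
      Uniform k H × NoIsolated H × UniquelyTauCritical H × IsTau (edges H) (ℓ + 1)
theorem6 (suc (suc (suc p))) ℓ n (s≤s (s≤s (s≤s _))) _ χ chromatic lower upper =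
  subst (λ n → Σ (Hypergraph n) λ H → Uniform (suc (suc (suc p))) H × NoIsolated H ×
                                       UniquelyTauCritical H × IsTau (edges H) (ℓ + 1))
        (m+[n∸m]≡n m≤n)
        (construction ℓ p m≡ℓ+j (surjectiveColouring m (suc p) χ (n ∸ m) chromatic j≤m χ≤c c≤N))
  where
  m : ℕ
  m = ℓ + suc (suc (suc p)) ∸ 1
  m≡ℓ+j : m ≡ ℓ + suc (suc p)
  m≡ℓ+j = cong (_∸ 1) (+-suc ℓ (suc (suc p)))
  j≤m : suc (suc p) ≤ m
  j≤m = subst (suc (suc p) ≤_) (sym m≡ℓ+j) (m≤n+m (suc (suc p)) ℓ)
  m≤n : m ≤ n
  m≤n = m+n≤o⇒n≤o χ lower
  χ≤c : χ ≤ n ∸ m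
  χ≤c = subst (_≤ n ∸ m) (m+n∸n≡m χ m) (∸-monoˡ-≤ m lower)
  c≤N : n ∸ m ≤ m C suc (suc p)
  c≤N = m≤n+o⇒m∸n≤o n m (subst (n ≤_) (+-comm (m C suc (suc p)) m) upper)
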